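{- There is no class function $f: S_3\to\mathbb{S}^1$ on the symmetric group $S_3$ on three symbols which is bent.
   Context: $\mathbb{S}^1=\{z\in\mathbb{C}: |z|=1\}$. A class function is a function constant on conjugacy classes. For a finite group $G$ with identity $e$, a function $f:G\to\mathbb{S}^1$ is called bent if and only if $\sum_{x\in G}\overline{f(x)}f(\sigma x)=0$ for every $\sigma\in G\setminus\{e\}$. -}

module Defs where

open import Level using (0ℓ)
open import Data.Fin using (Fin; zero; suc)
open import Data.Product using (_×_; _,_; proj₁; proj₂; ∃)
open import Data.List using (List; []; _∷_; foldr; map)
open import Relation.Binary.PropositionalEquality using (_≡_; refl)
open import Relation.Binary.Structures using (IsTotalOrder)
open import Relation.Nullary using (¬_)
open import Algebra.Structures using (IsCommutativeRing)

-- The real numbers, axiomatised as a (Dedekind-)complete ordered field.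
-- (agda-stdlib has no ℝ; every model of this record is isomorphic to ℝ.)

record CompleteOrderedField : Set₁ where
  infixl 6 _+_
  infixl 7 _*_
  field
    Carrier : Set
    _+_ _*_ : Carrier → Carrier → Carrier
    -_      : Carrier → Carrier
    0# 1#   : Carrier
    _⁻¹     : Carrier → Carrier
    _≤_     : Carrier → Carrier → Set
    isCommutativeRing : IsCommutativeRing _≡_ _+_ _*_ -_ 0# 1#
    0≢1     : ¬ (0# ≡ 1#)
    ⁻¹-inverse : ∀ x → ¬ (x ≡ 0#) → x * (x ⁻¹) ≡ 1#
    isTotalOrder : IsTotalOrder _≡_ _≤_
    +-mono-≤ : ∀ x y z → x ≤ y → (x + z) ≤ (y + z)
    *-nonneg : ∀ x y → 0# ≤ x → 0# ≤ y → 0# ≤ (x * y)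
    sup : (P : Carrier → Set) → ∃ P → ∃ (λ b → ∀ x → P x → x ≤ b) →
          ∃ (λ s → (∀ x → P x → x ≤ s) × (∀ b → (∀ x → P x → x ≤ b) → s ≤ b))

-- Complex numbers over such a field, as pairs (real part, imaginary part).

module Complex (R : CompleteOrderedField) where
  open CompleteOrderedField R

  ℂ : Set
  ℂ = Carrier × Carrier

  0ℂ : ℂ
  0ℂ = 0# , 0#

  _+ℂ_ : ℂ → ℂ → ℂ
  (a , b) +ℂ (c , d) = (a + c) , (b + d)

  _*ℂ_ : ℂ → ℂ → ℂ
  (a , b) *ℂ (c , d) = (a * c + - (b * d)) , (a * d + b * c)

  conj : ℂ → ℂ
  conj (a , b) = a , - b

  InS¹ : ℂ → Set
  InS¹ (a , b) = a * a + b * b ≡ 1#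

  sumℂ : List ℂ → ℂ
  sumℂ = foldr _+ℂ_ 0ℂ

-- The symmetric group S₃ on the three symbols 0,1,2.
-- Elements, named by cycle notation; `perm σ` is the permutation itself.

data S₃ : Set where
  e t01 t02 t12 c1 c2 : S₃

perm : S₃ → Fin 3 → Fin 3
perm e   i = i
perm t01 zero = suc zero
perm t01 (suc zero) = zero
perm t01 (suc (suc zero)) = suc (suc zero)
perm t02 zero = suc (suc zero)
perm t02 (suc zero) = suc zero
perm t02 (suc (suc zero)) = zero
perm t12 zero = zero
perm t12 (suc zero) = suc (suc zero)
perm t12 (suc (suc zero)) = suc zero
perm c1 zero = suc zero
perm c1 (suc zero) = suc (suc zero)
perm c1 (suc (suc zero)) = zero
perm c2 zero = suc (suc zero)
perm c2 (suc zero) = zero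
perm c2 (suc (suc zero)) = suc zero

-- a permutation of {0,1,2} is determined by the images of 0 and 1
decode : Fin 3 → Fin 3 → S₃
decode zero (suc zero) = e
decode (suc zero) zero = t01
decode (suc (suc zero)) (suc zero) = t02
decode zero (suc (suc zero)) = t12
decode (suc zero) (suc (suc zero)) = c1
decode (suc (suc zero)) zero = c2
decode _ _ = e

-- group product: (σ · τ)(i) = σ(τ(i))
_·_ : S₃ → S₃ → S₃
σ · τ = decode (perm σ (perm τ zero)) (perm σ (perm τ (suc zero)))

infixl 7 _·_

·-correct : ∀ σ τ i → perm (σ · τ) i ≡ perm σ (perm τ i)
·-correct e e zero = refl
·-correct e e (suc zero) = refl
·-correct e e (suc (suc zero)) = refl
·-correct e t01 zero = refl
·-correct e t01 (suc zero) = refl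
·-correct e t01 (suc (suc zero)) = refl
·-correct e t02 zero = refl
·-correct e t02 (suc zero) = refl
·-correct e t02 (suc (suc zero)) = refl
·-correct e t12 zero = refl
·-correct e t12 (suc zero) = refl
·-correct e t12 (suc (suc zero)) = refl
·-correct e c1 zero = refl
·-correct e c1 (suc zero) = refl
·-correct e c1 (suc (suc zero)) = refl
·-correct e c2 zero = refl
·-correct e c2 (suc zero) = refl
·-correct e c2 (suc (suc zero)) = refl
·-correct t01 e zero = refl
·-correct t01 e (suc zero) = refl
·-correct t01 e (suc (suc zero)) = refl
·-correct t01 t01 zero = refl
·-correct t01 t01 (suc zero) = refl
·-correct t01 t01 (suc (suc zero)) = refl
·-correct t01 t02 zero = refl
·-correct t01 t02 (suc zero) = refl
·-correct t01 t02 (suc (suc zero)) = refl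
·-correct t01 t12 zero = refl
·-correct t01 t12 (suc zero) = refl
·-correct t01 t12 (suc (suc zero)) = refl
·-correct t01 c1 zero = refl
·-correct t01 c1 (suc zero) = refl
·-correct t01 c1 (suc (suc zero)) = refl
·-correct t01 c2 zero = refl
·-correct t01 c2 (suc zero) = refl
·-correct t01 c2 (suc (suc zero)) = refl
·-correct t02 e zero = refl
·-correct t02 e (suc zero) = refl
·-correct t02 e (suc (suc zero)) = refl
·-correct t02 t01 zero = refl
·-correct t02 t01 (suc zero) = refl
·-correct t02 t01 (suc (suc zero)) = refl
·-correct t02 t02 zero = refl
·-correct t02 t02 (suc zero) = refl
·-correct t02 t02 (suc (suc zero)) = refl
·-correct t02 t12 zero = refl
·-correct t02 t12 (suc zero) = refl
·-correct t02 t12 (suc (suc zero)) = refl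
·-correct t02 c1 zero = refl
·-correct t02 c1 (suc zero) = refl
·-correct t02 c1 (suc (suc zero)) = refl
·-correct t02 c2 zero = refl
·-correct t02 c2 (suc zero) = refl
·-correct t02 c2 (suc (suc zero)) = refl
·-correct t12 e zero = refl
·-correct t12 e (suc zero) = refl
·-correct t12 e (suc (suc zero)) = refl
·-correct t12 t01 zero = refl
·-correct t12 t01 (suc zero) = refl
·-correct t12 t01 (suc (suc zero)) = refl
·-correct t12 t02 zero = refl
·-correct t12 t02 (suc zero) = refl
·-correct t12 t02 (suc (suc zero)) = refl
·-correct t12 t12 zero = refl
·-correct t12 t12 (suc zero) = refl
·-correct t12 t12 (suc (suc zero)) = refl
·-correct t12 c1 zero = refl
·-correct t12 c1 (suc zero) = refl
·-correct t12 c1 (suc (suc zero)) = refl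
·-correct t12 c2 zero = refl
·-correct t12 c2 (suc zero) = refl
·-correct t12 c2 (suc (suc zero)) = refl
·-correct c1 e zero = refl
·-correct c1 e (suc zero) = refl
·-correct c1 e (suc (suc zero)) = refl
·-correct c1 t01 zero = refl
·-correct c1 t01 (suc zero) = refl
·-correct c1 t01 (suc (suc zero)) = refl
·-correct c1 t02 zero = refl
·-correct c1 t02 (suc zero) = refl
·-correct c1 t02 (suc (suc zero)) = refl
·-correct c1 t12 zero = refl
·-correct c1 t12 (suc zero) = refl
·-correct c1 t12 (suc (suc zero)) = refl
·-correct c1 c1 zero = refl
·-correct c1 c1 (suc zero) = refl
·-correct c1 c1 (suc (suc zero)) = refl
·-correct c1 c2 zero = refl
·-correct c1 c2 (suc zero) = refl
·-correct c1 c2 (suc (suc zero)) = refl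
·-correct c2 e zero = refl
·-correct c2 e (suc zero) = refl
·-correct c2 e (suc (suc zero)) = refl
·-correct c2 t01 zero = refl
·-correct c2 t01 (suc zero) = refl
·-correct c2 t01 (suc (suc zero)) = refl
·-correct c2 t02 zero = refl
·-correct c2 t02 (suc zero) = refl
·-correct c2 t02 (suc (suc zero)) = refl
·-correct c2 t12 zero = refl
·-correct c2 t12 (suc zero) = refl
·-correct c2 t12 (suc (suc zero)) = refl
·-correct c2 c1 zero = refl
·-correct c2 c1 (suc zero) = refl
·-correct c2 c1 (suc (suc zero)) = refl
·-correct c2 c2 zero = refl
·-correct c2 c2 (suc zero) = refl
·-correct c2 c2 (suc (suc zero)) = refl
allS₃ : List S₃
allS₃ = e ∷ t01 ∷ t02 ∷ t12 ∷ c1 ∷ c2 ∷ []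

module _ (R : CompleteOrderedField) where
  open Complex R

  -- constant on conjugacy classes: x and g x g⁻¹ (i.e. any y with g·x = y·g)
  IsClassFunction : (S₃ → ℂ) → Set
  IsClassFunction f = ∀ g x y → g · x ≡ y · g → f x ≡ f y

  IntoS¹ : (S₃ → ℂ) → Set
  IntoS¹ f = ∀ x → InS¹ (f x)

  IsBent : (S₃ → ℂ) → Set
  IsBent f = ∀ σ → ¬ (σ ≡ e) → sumℂ (map (λ x → conj (f x) *ℂ f (σ · x)) allS₃) ≡ 0ℂ

module Submission where

-- A class function f on S₃ is determined by three values:
-- a = f(e), b = f(transpositions), c = f(3-cycles).  Evaluating the
-- bent condition at the 3-cycle σ = (0 1 2), the sum runs over
--   x = e ↦ āc,   x = transposition ↦ |b|² (three times),
--   x = σ ↦ |c|²,   x = σ² ↦ c̄a,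
-- and by the polarisation identity  |a + c|² = |a|² + 2 Re(āc) + |c|²
-- its real part satisfies  Re + |a|² = |a + c|² + 3|b|².
-- For values on the unit circle this gives  Re = (|a + c|² + 1) + 1,
-- which is nonzero in any ordered field, so the sum cannot vanish.

open import Defs
open import Level using (Level)
open import Data.Product using (_,_; proj₁)
open import Data.Sum using (inj₁; inj₂)
open import Data.Maybe using (nothing)
open import Data.List using (List; []; _∷_; foldr; map)
open import Data.List.Properties using (map-cong)
open import Function using (_∘_)
open import Relation.Nullary using (¬_)
open import Relation.Binary.PropositionalEquality
open import Relation.Binary.Structures using (IsTotalOrder)
open import Algebra.Bundles using (CommutativeRing)
import Algebra.Properties.Ring as RingProperties
import Algebra.Solver.Ring.NaturalCoefficients as NaturalCoefficients

module OrderedFieldFacts (R : CompleteOrderedField) where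
  open CompleteOrderedField R
  open IsTotalOrder isTotalOrder using (total; antisym) renaming (trans to ≤-trans)

  commutativeRing : CommutativeRing _ _
  commutativeRing = record { isCommutativeRing = isCommutativeRing }

  open CommutativeRing commutativeRing using (ring; +-identityˡ; -‿inverseʳ; *-identityˡ)
  open RingProperties ring using (-‿distribˡ-*; -‿distribʳ-*; -‿involutive)

  neg-mul-neg : ∀ x y → - ((- x) * y) ≡ x * y
  neg-mul-neg x y = trans (cong -_ (sym (-‿distribˡ-* x y))) (-‿involutive (x * y))

  neg-nonneg : ∀ x → x ≤ 0# → 0# ≤ (- x)
  neg-nonneg x x≤0 = subst₂ _≤_ (-‿inverseʳ x) (+-identityˡ (- x)) (+-mono-≤ x 0# (- x) x≤0)

  -- Every square is non-negative: split on the sign of x, using x·x = (−x)·(−x).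
  sq-nonneg : ∀ x → 0# ≤ (x * x)
  sq-nonneg x with total 0# x
  ... | inj₁ 0≤x = *-nonneg x x 0≤x 0≤x
  ... | inj₂ x≤0 = subst (0# ≤_) neg*neg (*-nonneg (- x) (- x) 0≤-x 0≤-x)
    where
    0≤-x : 0# ≤ (- x)
    0≤-x = neg-nonneg x x≤0
    neg*neg : (- x) * (- x) ≡ x * x
    neg*neg = trans (sym (-‿distribʳ-* (- x) x)) (neg-mul-neg x x)

  +-nonneg : ∀ u v → 0# ≤ u → 0# ≤ v → 0# ≤ (u + v)
  +-nonneg u v 0≤u 0≤v = ≤-trans 0≤v (subst (_≤ (u + v)) (+-identityˡ v) (+-mono-≤ 0# u v 0≤u))

  0≤1 : 0# ≤ 1#
  0≤1 = subst (0# ≤_) (*-identityˡ 1#) (sq-nonneg 1#)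

  nonneg+1≢0 : ∀ u → 0# ≤ u → u + 1# ≢ 0#
  nonneg+1≢0 u 0≤u u+1≡0 = 0≢1 (antisym 0≤1 1≤0)
    where
    1≤0 : 1# ≤ 0#
    1≤0 = subst₂ _≤_ (+-identityˡ 1#) u+1≡0 (+-mono-≤ 0# u 1# 0≤u)

-- A function on S₃ which is constant on conjugacy classes is determined by
-- its values at the representatives e, (0 1) and (0 1 2).
classFn : {ℓ : Level} {A : Set ℓ} → A → A → A → S₃ → A
classFn a b c e   = a
classFn a b c t01 = b
classFn a b c t02 = b
classFn a b c t12 = b
classFn a b c c1  = c
classFn a b c c2  = c

-- The conjugations (0 1)~(0 2), (0 1)~(1 2) and (0 1 2)~(0 2 1) suffice.
classFn-decomposition : {ℓ : Level} {A : Set ℓ} (f : S₃ → A) →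
                        (∀ g x y → g · x ≡ y · g → f x ≡ f y) →
                        ∀ x → f x ≡ classFn (f e) (f t01) (f c1) x
classFn-decomposition f conj-inv e   = refl
classFn-decomposition f conj-inv t01 = refl
classFn-decomposition f conj-inv t02 = conj-inv t12 t02 t01 refl
classFn-decomposition f conj-inv t12 = conj-inv t02 t12 t01 refl
classFn-decomposition f conj-inv c1  = refl
classFn-decomposition f conj-inv c2  = conj-inv t01 c2 c1 refl

module Autocorrelation (R : CompleteOrderedField) where
  open CompleteOrderedField R
  open Complex R
  open OrderedFieldFacts R
  open CommutativeRing commutativeRing using (commutativeSemiring; ring)
  open RingProperties ring using (+-cancelʳ)
  open NaturalCoefficients commutativeSemiring (λ _ _ → nothing)

  autocorrelation : (S₃ → ℂ) → S₃ → ℂ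
  autocorrelation f σ = sumℂ (map (λ x → conj (f x) *ℂ f (σ · x)) allS₃)

  autocorrelation-cong : (f g : S₃ → ℂ) → (∀ x → f x ≡ g x) →
                         ∀ σ → autocorrelation f σ ≡ autocorrelation g σ
  autocorrelation-cong f g f≗g σ =
    cong sumℂ (map-cong (λ x → cong₂ (λ u v → conj u *ℂ v) (f≗g x) (f≗g (σ · x))) allS₃)

  dot : ℂ → ℂ → Carrier
  dot (x₁ , x₂) (y₁ , y₂) = x₁ * y₁ + x₂ * y₂

  normSq : ℂ → Carrier
  normSq z = dot z z

  normSq-nonneg : ∀ z → 0# ≤ normSq z
  normSq-nonneg (x₁ , x₂) = +-nonneg _ _ (sq-nonneg x₁) (sq-nonneg x₂)

  re-conj-mul : ∀ z w → proj₁ (conj z *ℂ w) ≡ dot z w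
  re-conj-mul (x₁ , x₂) (y₁ , y₂) = cong (x₁ * y₁ +_) (neg-mul-neg x₂ y₂)

  re-sum-conj-mul : {A : Set} (u v : A → ℂ) (xs : List A) →
    proj₁ (sumℂ (map (λ x → conj (u x) *ℂ v x) xs)) ≡ foldr _+_ 0# (map (λ x → dot (u x) (v x)) xs)
  re-sum-conj-mul u v []       = refl
  re-sum-conj-mul u v (x ∷ xs) = cong₂ _+_ (re-conj-mul (u x) (v x)) (re-sum-conj-mul u v xs)

  polarisation : ∀ z w → normSq (z +ℂ w) ≡ normSq z + (dot z w + dot w z) + normSq w
  polarisation (x₁ , x₂) (y₁ , y₂) = solve 4
    (λ x₁ x₂ y₁ y₂ →
      (x₁ :+ y₁) :* (x₁ :+ y₁) :+ (x₂ :+ y₂) :* (x₂ :+ y₂)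
      := (x₁ :* x₁ :+ x₂ :* x₂) :+ ((x₁ :* y₁ :+ x₂ :* y₂) :+ (y₁ :* x₁ :+ y₂ :* x₂)) :+ (y₁ :* y₁ :+ y₂ :* y₂))
    refl x₁ x₂ y₁ y₂

  re-autocorrelation-c1 : ∀ a b c →
    proj₁ (autocorrelation (classFn a b c) c1) + normSq a ≡ normSq (a +ℂ c) + (normSq b + normSq b + normSq b)
  re-autocorrelation-c1 a b c = begin
    proj₁ (autocorrelation (classFn a b c) c1) + normSq a
      ≡⟨ cong (_+ normSq a) (re-sum-conj-mul (classFn a b c) (classFn a b c ∘ (c1 ·_)) allS₃) ⟩
    (dot a c + (normSq b + (normSq b + (normSq b + (normSq c + (dot c a + 0#)))))) + normSq a
      ≡⟨ regroup (dot a c) (dot c a) (normSq a) (normSq b) (normSq c) ⟩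
    normSq a + (dot a c + dot c a) + normSq c + (normSq b + normSq b + normSq b)
      ≡⟨ cong (_+ (normSq b + normSq b + normSq b)) (sym (polarisation a c)) ⟩
    normSq (a +ℂ c) + (normSq b + normSq b + normSq b) ∎
    where
    open ≡-Reasoning
    regroup : ∀ ac ca na nb nc →
      (ac + (nb + (nb + (nb + (nc + (ca + 0#)))))) + na ≡ na + (ac + ca) + nc + (nb + nb + nb)
    regroup = solve 5 (λ ac ca na nb nc →
      (ac :+ (nb :+ (nb :+ (nb :+ (nc :+ (ca :+ con 0)))))) :+ na
      := na :+ (ac :+ ca) :+ nc :+ (nb :+ nb :+ nb)) refl

  -- For unit values the real part is (|a + c|² + 1) + 1, hence nonzero.
  re-autocorrelation-c1≢0 : ∀ a b c → InS¹ a → InS¹ b → InS¹ c →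
                            proj₁ (autocorrelation (classFn a b c) c1) ≢ 0#
  re-autocorrelation-c1≢0 a b c |a|≡1 |b|≡1 _ =
    nonneg+1≢0 (normSq (a +ℂ c) + 1#) (+-nonneg _ _ (normSq-nonneg (a +ℂ c)) 0≤1)
      ∘ trans (sym re≡)
    where
    open ≡-Reasoning
    three-ones : ∀ s → s + (1# + 1# + 1#) ≡ s + 1# + 1# + 1#
    three-ones = solve 1 (λ s → s :+ (con 1 :+ con 1 :+ con 1) := s :+ con 1 :+ con 1 :+ con 1) refl
    re+1≡ : proj₁ (autocorrelation (classFn a b c) c1) + 1# ≡ normSq (a +ℂ c) + 1# + 1# + 1#
    re+1≡ = begin
      proj₁ (autocorrelation (classFn a b c) c1) + 1#
        ≡⟨ cong (proj₁ (autocorrelation (classFn a b c) c1) +_) (sym |a|≡1) ⟩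
      proj₁ (autocorrelation (classFn a b c) c1) + normSq a
        ≡⟨ re-autocorrelation-c1 a b c ⟩
      normSq (a +ℂ c) + (normSq b + normSq b + normSq b)
        ≡⟨ cong (λ nb → normSq (a +ℂ c) + (nb + nb + nb)) |b|≡1 ⟩
      normSq (a +ℂ c) + (1# + 1# + 1#)
        ≡⟨ three-ones (normSq (a +ℂ c)) ⟩
      normSq (a +ℂ c) + 1# + 1# + 1# ∎
    re≡ : proj₁ (autocorrelation (classFn a b c) c1) ≡ normSq (a +ℂ c) + 1# + 1#
    re≡ = +-cancelʳ 1# _ _ re+1≡

proposition2p5 : (R : CompleteOrderedField) (f : S₃ → Complex.ℂ R) →
                 IntoS¹ R f → IsClassFunction R f → ¬ IsBent R f
proposition2p5 R f unit classFunction bent =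
  re-autocorrelation-c1≢0 a b c (unit e) (unit t01) (unit c1) (cong proj₁ vanishes)
  where
  open Autocorrelation R
  a b c : Complex.ℂ R
  a = f e
  b = f t01
  c = f c1
  vanishes : autocorrelation (classFn a b c) c1 ≡ Complex.0ℂ R
  vanishes = trans (sym (autocorrelation-cong f (classFn a b c) (classFn-decomposition f classFunction) c1))
                   (bent c1 (λ ()))
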